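{- Let $r\ge 3$ and $a,b$ positive integers with $a+b=r$. (i) If $2\le a,b\le r-2$, then for each $k$ with $0\le k\le r-2$ and for $k=r$, the family $\mathcal J^{(k)}$ contains disjoint members $A$ and $B$ with $|A|=a$ and $|B|=b$, unless $(r,a,b,k)=(4,2,2,1)$. (ii) If $(a,b)=(1,r-1)$ or $(a,b)=(r-1,1)$, then for each $k$ with $1\le k\le r-2$ and for $k=r$, the family $\mathcal J^{(k)}$ contains disjoint members $A$ and $B$ with $|A|=a$ and $|B|=b$.
   Context: For $k\in\{0,1,\dots,r\}$, $\mathcal J^{(k)}$ is the family of proper subsets of $[r]=\{1,\dots,r\}$ consisting of: (a) the sets $[r]\setminus\{i\}$ for $1\le i\le k$; (b) all $(r-2)$-element subsets of $[r]$ containing $\{1,2,\dots,k\}$; and (c) all intersections of sets from (a) and (b). -}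

module Defs where

open import Data.Nat using (ℕ; _<_; _∸_)
open import Data.Fin using (Fin; toℕ)
open import Data.Fin.Subset using (Subset; _∩_; ∁; ⁅_⁆; ∣_∣; _∈_; ⊥)
open import Data.Product using (_×_; ∃₂)
open import Relation.Binary.PropositionalEquality using (_≡_)

-- Ground set [r] = {1,…,r} is modelled by Fin r, with element i : Fin r
-- standing for the integer toℕ i + 1.  Hence "i ∈ {1,…,k}" is  toℕ i < k.

data Gen (r k : ℕ) : Subset r → Set where
  genA : (i : Fin r) → toℕ i < k → Gen r k (∁ ⁅ i ⁆)
  genB : (S : Subset r) → ∣ S ∣ ≡ r ∸ 2
       → (∀ (i : Fin r) → toℕ i < k → i ∈ S) → Gen r k S

data 𝒥 (r k : ℕ) : Subset r → Set where
  gen : ∀ {S} → Gen r k S → 𝒥 r k S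
  cap : ∀ {S T} → 𝒥 r k S → 𝒥 r k T → 𝒥 r k (S ∩ T)

HasDisjointPair : (r k a b : ℕ) → Set
HasDisjointPair r k a b =
  ∃₂ λ (A B : Subset r) →
    𝒥 r k A × 𝒥 r k B × ∣ A ∣ ≡ a × ∣ B ∣ ≡ b × (A ∩ B ≡ ⊥)

module Submission where

-- Pass to complements: a set lies in 𝒥^(k) as soon as its complement is a union of
-- singletons {i} with i ≤ k and of 2-sets avoiding {1,…,k}.  An interval is such a union
-- unless exactly one of its points exceeds k.  Hence A = {1,…,a} and B = {a+1,…,r} work
-- whenever a ≠ k+1 (and b ≥ 2 or k = r), and symmetrically when b ≠ k+1.  If a = b = k+1
-- with k ≥ 2, take A = {2,…,k+2} and B its complement; k = 1 is the exception (4,2,2,1).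

open import Defs
open import Data.Nat using (ℕ; zero; suc; _+_; _∸_; _≤_; _<_; z≤n; s≤s; s≤s⁻¹; s<s⁻¹; _≟_; _≤?_; _<?_)
open import Data.Nat.Properties
open import Data.Fin using (Fin; toℕ; fromℕ<) renaming (zero to fzero; suc to fsuc)
open import Data.Fin.Properties using (toℕ<n; toℕ-fromℕ<)
open import Data.Fin.Subset using (Subset; inside; outside; _∪_; ∁; ⁅_⁆; ∣_∣; _∈_; _⊆_; ⊥)
open import Data.Fin.Subset.Properties
import Algebra.Lattice.Properties.BooleanAlgebra as BooleanAlgebraProperties
open import Data.Vec.Base using ([]; _∷_; here; there)
open import Data.Product using (_×_; _,_; proj₁; proj₂)
open import Data.Sum using (_⊎_; inj₁; inj₂; [_,_]′; map₂)
open import Relation.Nullary using (¬_; yes; no; contradiction)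
open import Relation.Binary.PropositionalEquality
open import Function using (_∘_)

m≢1+n⇒m≤n⊎2+n≤m : ∀ {m n} → m ≢ suc n → m ≤ n ⊎ 2 + n ≤ m
m≢1+n⇒m≤n⊎2+n≤m {m} {n} m≢1+n with m ≤? n
... | yes m≤n = inj₁ m≤n
... | no  m≰n = inj₂ (≤∧≢⇒< (≰⇒> m≰n) (m≢1+n ∘ sym))

m≤o∸n⇒n+m≤o : ∀ {m n o} → n ≤ o → m ≤ o ∸ n → n + m ≤ o
m≤o∸n⇒n+m≤o {m} {n} {o} n≤o m≤o∸n = subst (_≤ o) (+-comm m n) (m≤o∸n⇒m+n≤o m n≤o m≤o∸n)

-- interval l h is {i | l ≤ i < h}; in the paper's 1-based notation it is {l+1, …, h}.
interval : ∀ {r} → ℕ → ℕ → Subset r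
interval {zero}  _       _       = []
interval {suc r} _       zero    = ⊥
interval {suc r} zero    (suc h) = inside ∷ interval zero h
interval {suc r} (suc l) (suc h) = outside ∷ interval l h

∈-interval⁺ : ∀ {r l h} {i : Fin r} → l ≤ toℕ i → toℕ i < h → i ∈ interval l h
∈-interval⁺ {l = zero}  {suc h} {fzero}  _   _   = here
∈-interval⁺ {l = zero}  {suc h} {fsuc i} _   i<h = there (∈-interval⁺ z≤n (s≤s⁻¹ i<h))
∈-interval⁺ {l = suc l} {suc h} {fsuc i} l≤i i<h = there (∈-interval⁺ (s≤s⁻¹ l≤i) (s≤s⁻¹ i<h))

∈-interval⁻ : ∀ {r l h} {i : Fin r} → i ∈ interval l h → l ≤ toℕ i × toℕ i < h
∈-interval⁻ {suc _} {h = zero} i∈ = contradiction i∈ ∉⊥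
∈-interval⁻ {l = zero}  {suc h} {fzero}  here       = z≤n , s≤s z≤n
∈-interval⁻ {l = zero}  {suc h} {fsuc i} (there i∈) = z≤n , s≤s (proj₂ (∈-interval⁻ i∈))
∈-interval⁻ {l = suc l} {suc h} {fsuc i} (there i∈) =
  let l≤i , i<h = ∈-interval⁻ i∈ in s≤s l≤i , s≤s i<h

∣interval∣ : ∀ {r} l {h} → h ≤ r → ∣ interval {r} l h ∣ ≡ h ∸ l
∣interval∣ {zero}  l               z≤n = sym (0∸n≡0 l)
∣interval∣ {suc r} l       {zero}  _   = trans (∣⊥∣≡0 (suc r)) (sym (0∸n≡0 l))
∣interval∣ {suc r} zero    {suc h} h≤r = cong suc (∣interval∣ zero (s≤s⁻¹ h≤r))
∣interval∣ {suc r} (suc l) {suc h} h≤r = ∣interval∣ l (s≤s⁻¹ h≤r)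

interval-empty : ∀ {r} l → interval {r} l 0 ≡ ⊥
interval-empty {zero}  _ = refl
interval-empty {suc r} _ = refl

interval-singleton : ∀ {r j} (j<r : j < r) → interval j (suc j) ≡ ⁅ fromℕ< j<r ⁆
interval-singleton {suc r} {zero}  _   = cong (inside ∷_) (interval-empty zero)
interval-singleton {suc r} {suc j} j<r = cong (outside ∷_) (interval-singleton (s<s⁻¹ j<r))

interval-∪ : ∀ {r l m h h′} → l ≤ m → m ≤ h → h ≤ h′ →
             interval {r} l h ∪ interval m h′ ≡ interval l h′
interval-∪ {r} {l} {m} {h} {h′} l≤m m≤h h≤h′ = ⊆-antisym lhs⊆rhs rhs⊆lhs
  where
  lhs⊆rhs : interval l h ∪ interval m h′ ⊆ interval l h′
  lhs⊆rhs i∈ with x∈p∪q⁻ (interval l h) _ i∈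
  ... | inj₁ i∈lh  = let l≤i , i<h = ∈-interval⁻ i∈lh in ∈-interval⁺ l≤i (<-≤-trans i<h h≤h′)
  ... | inj₂ i∈mh′ = let m≤i , i<h′ = ∈-interval⁻ i∈mh′ in ∈-interval⁺ (≤-trans l≤m m≤i) i<h′
  rhs⊆lhs : interval l h′ ⊆ interval l h ∪ interval m h′
  rhs⊆lhs {i} i∈ with ∈-interval⁻ i∈ | toℕ i <? h
  ... | l≤i , _    | yes i<h = x∈p∪q⁺ (inj₁ (∈-interval⁺ l≤i i<h))
  ... | _   , i<h′ | no  i≮h = x∈p∪q⁺ (inj₂ (∈-interval⁺ (≤-trans m≤h (≮⇒≥ i≮h)) i<h′))

∁-interval : ∀ {r} l h → ∁ (interval {r} l h) ≡ interval 0 l ∪ interval h r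
∁-interval {r} l h = ⊆-antisym lhs⊆rhs rhs⊆lhs
  where
  lhs⊆rhs : ∁ (interval l h) ⊆ interval 0 l ∪ interval h r
  lhs⊆rhs {i} i∈ with toℕ i <? l | toℕ i <? h
  ... | yes i<l | _       = x∈p∪q⁺ (inj₁ (∈-interval⁺ z≤n i<l))
  ... | no  i≮l | yes i<h = contradiction (∈-interval⁺ (≮⇒≥ i≮l) i<h) (x∈∁p⇒x∉p i∈)
  ... | no  _   | no  i≮h = x∈p∪q⁺ (inj₂ (∈-interval⁺ (≮⇒≥ i≮h) (toℕ<n i)))
  rhs⊆lhs : interval 0 l ∪ interval h r ⊆ ∁ (interval l h)
  rhs⊆lhs {i} i∈ = x∉p⇒x∈∁p λ i∈lh → let l≤i , i<h = ∈-interval⁻ i∈lh in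
    [ (λ i∈0l → <⇒≱ (proj₂ (∈-interval⁻ i∈0l)) l≤i)
    , (λ i∈hr → <⇒≱ i<h (proj₁ (∈-interval⁻ i∈hr))) ]′ (x∈p∪q⁻ _ _ i∈)

module _ {r : ℕ} (P : Subset r → Set) (P-∪ : ∀ {S T} → P S → P T → P (S ∪ T)) where

  interval-from-windows : ∀ w {l h} → 1 ≤ w →
    (∀ e → w + l ≤ e → e ≤ h → P (interval (e ∸ w) e)) → w + l ≤ h → P (interval l h)
  interval-from-windows w {l} {h} 1≤w window w+l≤h with m≤n⇒m<n∨m≡n w+l≤h
  ... | inj₂ refl = subst (λ x → P (interval x h)) (m+n∸m≡n w l) (window h ≤-refl ≤-refl)
  ... | inj₁ (s≤s {n = h′} w+l≤h′) =
    subst P (interval-∪ l≤h+1∸w h+1∸w≤h (n≤1+n h′))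
      (P-∪ (interval-from-windows w 1≤w (λ e w+l≤e e≤h′ → window e w+l≤e (m≤n⇒m≤1+n e≤h′)) w+l≤h′)
           (window (suc h′) (m≤n⇒m≤1+n w+l≤h′) ≤-refl))
    where
    l≤h+1∸w : l ≤ suc h′ ∸ w
    l≤h+1∸w = m+n≤o⇒m≤o∸n l (subst (_≤ suc h′) (+-comm w l) (m≤n⇒m≤1+n w+l≤h′))
    h+1∸w≤h : suc h′ ∸ w ≤ h′
    h+1∸w≤h = ∸-monoʳ-≤ (suc h′) 1≤w

𝒥ᶜ : (r k : ℕ) → Subset r → Set
𝒥ᶜ r k S = 𝒥 r k (∁ S)

module _ {r k : ℕ} where
  open BooleanAlgebraProperties (∪-∩-booleanAlgebra r) using (deMorgan₂; ¬-involutive)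

  𝒥ᶜ-∪ : ∀ {S T} → 𝒥ᶜ r k S → 𝒥ᶜ r k T → 𝒥ᶜ r k (S ∪ T)
  𝒥ᶜ-∪ {S} {T} ∁S∈𝒥 ∁T∈𝒥 = subst (𝒥 r k) (sym (deMorgan₂ S T)) (cap ∁S∈𝒥 ∁T∈𝒥)

  𝒥ᶜ-singleton : ∀ {j} → j < k → j < r → 𝒥ᶜ r k (interval j (suc j))
  𝒥ᶜ-singleton j<k j<r = subst (𝒥ᶜ r k) (sym (interval-singleton j<r))
    (gen (genA (fromℕ< j<r) (subst (_< k) (sym (toℕ-fromℕ< j<r)) j<k)))

  𝒥ᶜ-pair : ∀ {j} → k ≤ j → 2 + j ≤ r → 𝒥ᶜ r k (interval j (2 + j))
  𝒥ᶜ-pair {j} k≤j 2+j≤r = gen (genB _ size k⊆)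
    where
    size : ∣ ∁ (interval {r} j (2 + j)) ∣ ≡ r ∸ 2
    size = trans (∣∁p∣≡n∸∣p∣ (interval {r} j (2 + j)))
                 (cong (r ∸_) (trans (∣interval∣ j 2+j≤r) (m+n∸n≡m 2 j)))
    k⊆ : ∀ i → toℕ i < k → i ∈ ∁ (interval j (2 + j))
    k⊆ i i<k = x∉p⇒x∈∁p λ i∈ → <⇒≱ (<-≤-trans i<k k≤j) (proj₁ (∈-interval⁻ i∈))

  𝒥ᶜ-interval-below : ∀ {l h} → l < h → h ≤ k → h ≤ r → 𝒥ᶜ r k (interval l h)
  𝒥ᶜ-interval-below {l} {h} l<h h≤k h≤r =
    interval-from-windows (𝒥ᶜ r k) 𝒥ᶜ-∪ 1 ≤-refl singleton l<h
    where
    singleton : ∀ e → suc l ≤ e → e ≤ h → 𝒥ᶜ r k (interval (e ∸ 1) e)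
    singleton (suc j) _ e≤h = 𝒥ᶜ-singleton (≤-trans e≤h h≤k) (≤-trans e≤h h≤r)

  𝒥ᶜ-interval-above : ∀ {l h} → k ≤ l → 2 + l ≤ h → h ≤ r → 𝒥ᶜ r k (interval l h)
  𝒥ᶜ-interval-above {l} {h} k≤l 2+l≤h h≤r =
    interval-from-windows (𝒥ᶜ r k) 𝒥ᶜ-∪ 2 (s≤s z≤n) pair 2+l≤h
    where
    pair : ∀ e → 2 + l ≤ e → e ≤ h → 𝒥ᶜ r k (interval (e ∸ 2) e)
    pair 1             (s≤s ())  _
    pair (suc (suc j)) 2+l≤e e≤h = 𝒥ᶜ-pair (≤-trans k≤l (s≤s⁻¹ (s≤s⁻¹ 2+l≤e))) (≤-trans e≤h h≤r)

  -- The part of [l, h) outside [0, k) must be empty or have at least two elements.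
  𝒥ᶜ-interval : ∀ {l h} → l < h → h ≤ r → h ≤ k ⊎ (2 + l ≤ h × 2 + k ≤ h) → 𝒥ᶜ r k (interval l h)
  𝒥ᶜ-interval l<h h≤r (inj₁ h≤k) = 𝒥ᶜ-interval-below l<h h≤k h≤r
  𝒥ᶜ-interval {l} {h} l<h h≤r (inj₂ (2+l≤h , 2+k≤h)) with k ≤? l
  ... | yes k≤l = 𝒥ᶜ-interval-above k≤l 2+l≤h h≤r
  ... | no  k≰l = subst (𝒥ᶜ r k) (interval-∪ (<⇒≤ l<k) ≤-refl k≤h)
        (𝒥ᶜ-∪ (𝒥ᶜ-interval-below l<k ≤-refl (≤-trans k≤h h≤r)) (𝒥ᶜ-interval-above ≤-refl 2+k≤h h≤r))
    where
    l<k : l < k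
    l<k = ≰⇒> k≰l
    k≤h : k ≤ h
    k≤h = m+n≤o⇒n≤o 2 2+k≤h

  disjointPair-complementary : ∀ {A} → 𝒥ᶜ r k A → 𝒥ᶜ r k (∁ A) →
                               HasDisjointPair r k ∣ A ∣ (r ∸ ∣ A ∣)
  disjointPair-complementary {A} ∁A∈𝒥 A∈𝒥 =
    A , ∁ A , subst (𝒥 r k) (¬-involutive A) A∈𝒥 , ∁A∈𝒥 , refl , ∣∁p∣≡n∸∣p∣ A , ∩-inverseʳ A

  disjointPair-swap : ∀ {a b} → HasDisjointPair r k a b → HasDisjointPair r k b a
  disjointPair-swap (A , B , A∈𝒥 , B∈𝒥 , ∣A∣ , ∣B∣ , A∩B) =
    B , A , B∈𝒥 , A∈𝒥 , ∣B∣ , ∣A∣ , trans (∩-comm B A) A∩B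

  disjointPair-interval : ∀ {l h a b} → h ≤ r → h ∸ l ≡ a → a + b ≡ r →
    𝒥ᶜ r k (interval l h) → 𝒥ᶜ r k (interval 0 l ∪ interval h r) → HasDisjointPair r k a b
  disjointPair-interval {l} {h} {a} {b} h≤r h∸l≡a a+b≡r ∁I∈𝒥 I∈𝒥 =
    subst₂ (HasDisjointPair r k) ∣I∣≡a r∸∣I∣≡b
      (disjointPair-complementary ∁I∈𝒥 (subst (𝒥ᶜ r k) (sym (∁-interval l h)) I∈𝒥))
    where
    ∣I∣≡a : ∣ interval {r} l h ∣ ≡ a
    ∣I∣≡a = trans (∣interval∣ l h≤r) h∸l≡a
    r∸∣I∣≡b : r ∸ ∣ interval {r} l h ∣ ≡ b
    r∸∣I∣≡b = begin
      r ∸ ∣ interval {r} l h ∣ ≡⟨ cong (r ∸_) ∣I∣≡a ⟩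
      r ∸ a                    ≡⟨ cong (_∸ a) a+b≡r ⟨
      a + b ∸ a                ≡⟨ m+n∸m≡n a b ⟩
      b                        ∎
      where open ≡-Reasoning

  disjointPair-prefix : ∀ {a b} → a + b ≡ r → 0 < a → a < r →
    a ≤ k ⊎ (2 ≤ a × 2 + k ≤ a) → r ≤ k ⊎ (2 + a ≤ r × 2 + k ≤ r) → HasDisjointPair r k a b
  disjointPair-prefix {a} a+b≡r 0<a a<r a-ok r-ok =
    disjointPair-interval (<⇒≤ a<r) refl a+b≡r (𝒥ᶜ-interval 0<a (<⇒≤ a<r) a-ok)
      (subst (𝒥ᶜ r k) (sym ∅∪I≡I) (𝒥ᶜ-interval a<r ≤-refl r-ok))
    where
    ∅∪I≡I : interval 0 0 ∪ interval a r ≡ interval a r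
    ∅∪I≡I = trans (cong (_∪ interval a r) (interval-empty 0)) (∪-identityˡ (interval a r))

  disjointPair-a≢1+k : ∀ {a b} → a + b ≡ r → 1 ≤ a → 2 ≤ b → 2 + k ≤ r →
    a ≢ suc k → HasDisjointPair r k a b
  disjointPair-a≢1+k {a} a+b≡r 1≤a 2≤b 2+k≤r a≢1+k =
    disjointPair-prefix a+b≡r 1≤a (m+n≤o⇒n≤o 1 2+a≤r)
      (map₂ (λ 2+k≤a → ≤-trans (m≤m+n 2 k) 2+k≤a , 2+k≤a) (m≢1+n⇒m≤n⊎2+n≤m a≢1+k)) (inj₂ (2+a≤r , 2+k≤r))
    where
    2+a≤r : 2 + a ≤ r
    2+a≤r = subst₂ _≤_ (+-comm a 2) a+b≡r (+-monoʳ-≤ a 2≤b)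

  disjointPair-a≡b≡1+k : 2 ≤ k → suc k + suc k ≡ r → HasDisjointPair r k (suc k) (suc k)
  disjointPair-a≡b≡1+k 2≤k a+b≡r =
    disjointPair-interval 2+k≤r refl a+b≡r
      (𝒥ᶜ-interval (s≤s (s≤s z≤n)) 2+k≤r (inj₂ (s≤s (s≤s 1≤k) , ≤-refl)))
      (𝒥ᶜ-∪ (𝒥ᶜ-interval (s≤s z≤n) (≤-trans (s≤s z≤n) 2+k≤r) (inj₁ 1≤k))
            (𝒥ᶜ-interval (m+n≤o⇒n≤o 1 4+k≤r) ≤-refl (inj₂ (4+k≤r , 2+k≤r))))
    where
    1≤k : 1 ≤ k
    1≤k = ≤-trans (s≤s z≤n) 2≤k
    4+k≤r : 4 + k ≤ r
    4+k≤r = subst₂ _≤_ (+-comm (suc k) 3) a+b≡r (+-monoʳ-≤ (suc k) (s≤s 2≤k))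
    2+k≤r : 2 + k ≤ r
    2+k≤r = m+n≤o⇒n≤o 2 4+k≤r

  disjointPair-2≤a-2≤b : ∀ {a b} → a + b ≡ r → 2 ≤ a → 2 ≤ b → 2 + k ≤ r →
    ¬ (r ≡ 4 × a ≡ 2 × b ≡ 2 × k ≡ 1) → HasDisjointPair r k a b
  disjointPair-2≤a-2≤b {a} {b} a+b≡r 2≤a 2≤b 2+k≤r not-exceptional with a ≟ suc k | b ≟ suc k
  ... | no a≢1+k | _ =
    disjointPair-a≢1+k a+b≡r (m+n≤o⇒n≤o 1 2≤a) 2≤b 2+k≤r a≢1+k
  ... | yes _ | no b≢1+k = disjointPair-swap
    (disjointPair-a≢1+k (trans (+-comm b a) a+b≡r) (m+n≤o⇒n≤o 1 2≤b) 2≤a 2+k≤r b≢1+k)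
  ... | yes refl | yes refl with k ≟ 1
  ...   | yes refl = contradiction (sym a+b≡r , refl , refl , refl) not-exceptional
  ...   | no  k≢1  = disjointPair-a≡b≡1+k (≤∧≢⇒< (s≤s⁻¹ 2≤a) (k≢1 ∘ sym)) a+b≡r

disjointPair-k≡r : ∀ {r a b} → a + b ≡ r → 1 ≤ a → 1 ≤ b → HasDisjointPair r r a b
disjointPair-k≡r {r} {a} a+b≡r 1≤a 1≤b = disjointPair-prefix a+b≡r 1≤a a<r (inj₁ (<⇒≤ a<r)) (inj₁ ≤-refl)
  where
  a<r : a < r
  a<r = subst (a <_) a+b≡r (m<m+n a 1≤b)

lemma9 : (r a b : ℕ) → 3 ≤ r → 1 ≤ a → 1 ≤ b → a + b ≡ r →
    ((2 ≤ a → 2 ≤ b → a ≤ r ∸ 2 → b ≤ r ∸ 2 →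
       (k : ℕ) → (k ≤ r ∸ 2 ⊎ k ≡ r) →
       ¬ (r ≡ 4 × a ≡ 2 × b ≡ 2 × k ≡ 1) →
       HasDisjointPair r k a b)
    ×
     (((a ≡ 1 × b ≡ r ∸ 1) ⊎ (a ≡ r ∸ 1 × b ≡ 1)) →
       (k : ℕ) → ((1 ≤ k × k ≤ r ∸ 2) ⊎ k ≡ r) →
       HasDisjointPair r k a b))
lemma9 r a b 3≤r 1≤a 1≤b a+b≡r =
  (λ { 2≤a 2≤b _ _ k (inj₁ k≤r∸2) not-exceptional →
         disjointPair-2≤a-2≤b a+b≡r 2≤a 2≤b (m≤o∸n⇒n+m≤o 2≤r k≤r∸2) not-exceptional
     ; _ _ _ _ k (inj₂ refl) _ → disjointPair-k≡r a+b≡r 1≤a 1≤b })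
  ,
  (λ { (inj₁ (refl , _)) k (inj₁ (1≤k , k≤r∸2)) →
         disjointPair-a≢1+k a+b≡r 1≤a (1+c≡r⇒2≤c a+b≡r) (m≤o∸n⇒n+m≤o 2≤r k≤r∸2) (1≢1+k 1≤k)
     ; (inj₂ (_ , refl)) k (inj₁ (1≤k , k≤r∸2)) → disjointPair-swap
         (disjointPair-a≢1+k b+a≡r 1≤b (1+c≡r⇒2≤c b+a≡r) (m≤o∸n⇒n+m≤o 2≤r k≤r∸2) (1≢1+k 1≤k))
     ; _ k (inj₂ refl) → disjointPair-k≡r a+b≡r 1≤a 1≤b })
  where
  2≤r : 2 ≤ r
  2≤r = m+n≤o⇒n≤o 1 3≤r
  b+a≡r : b + a ≡ r
  b+a≡r = trans (+-comm b a) a+b≡r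
  1+c≡r⇒2≤c : ∀ {c} → 1 + c ≡ r → 2 ≤ c
  1+c≡r⇒2≤c 1+c≡r = s≤s⁻¹ (subst (3 ≤_) (sym 1+c≡r) 3≤r)
  1≢1+k : ∀ {k} → 1 ≤ k → 1 ≢ suc k
  1≢1+k () refl
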